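{- Let $(R,v)$ be a discrete valuation domain. Let $f=a_0+a_1x+\cdots+a_nx^n\in R[x]$ be such that there exists an index $j$ with $1\leq j\leq n$ for which the following hold: (i) $v(a_j)=0$; (ii) $\frac{v(a_0)}{j}<\frac{v(a_i)}{j-i}$ for each $i=1,\ldots,j-1$; (iii) $\gcd(v(a_0),\,j)=1$. Then any factorization $f(x)=f_1(x)f_2(x)$ of $f$ in $R[x]$ satisfies $v(f_1(0))=v(a_0)$ or $v(f_2(0))=v(a_0)$.
   Context: A discrete valuation domain $(R,v)$ is an integral domain $R$ which is the valuation ring of a discrete valuation $v$ (with values in $\mathbb{Z}\cup\{\infty\}$, $v(0)=\infty$) on its field of fractions; thus $v\geq 0$ on $R$. -}

module Defs where

open import Level using (_⊔_)
open import Data.Nat using (ℕ; zero; suc; _∸_; _<_; _≤_)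
import Data.Nat as N
open import Data.List using (List; []; _∷_; map)
open import Data.Product using (∃)
open import Data.Unit using (⊤)
open import Relation.Nullary using (¬_)
open import Relation.Binary.PropositionalEquality using (_≡_)
open import Algebra.Bundles using (CommutativeRing)

-- Value set ℕ ∪ {∞} of a discrete valuation restricted to its valuation ring
-- (v ≥ 0 on R, v(0) = ∞).
data ℕ∞ : Set where
  fin : ℕ → ℕ∞
  ∞   : ℕ∞

_+∞_ : ℕ∞ → ℕ∞ → ℕ∞
fin m +∞ fin n = fin (m N.+ n)
fin _ +∞ ∞     = ∞
∞     +∞ _     = ∞

data _≤∞_ : ℕ∞ → ℕ∞ → Set where
  fin≤fin : ∀ {m n} → m ≤ n → fin m ≤∞ fin n
  _≤∞∞    : ∀ x → x ≤∞ ∞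

min∞ : ℕ∞ → ℕ∞ → ℕ∞
min∞ (fin m) (fin n) = fin (m N.⊓ n)
min∞ (fin m) ∞       = fin m
min∞ ∞       y       = y

-- (R, v) is a discrete valuation domain: R is an integral domain and v is a
-- discrete valuation on Frac(R) (values in ℤ ∪ {∞}) whose valuation ring is
-- exactly R.  Restricted to R this means: v takes values in ℕ ∪ {∞},
-- v(x) = ∞ iff x = 0, v(xy) = v(x)+v(y), v(x+y) ≥ min(v(x),v(y)), and
-- an element y/x of Frac(R) (x ≠ 0) with v(y/x) ≥ 0 already lies in R,
-- i.e. v(x) ≤ v(y) implies x ∣ y in R.
record IsDVR {c ℓ} (R : CommutativeRing c ℓ)
             (v : CommutativeRing.Carrier R → ℕ∞) : Set (c ⊔ ℓ) where
  open CommutativeRing R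
  field
    nontrivial : ¬ (1# ≈ 0#)
    v-cong     : ∀ {x y} → x ≈ y → v x ≡ v y
    v-zero     : v 0# ≡ ∞
    v-∞        : ∀ x → v x ≡ ∞ → x ≈ 0#
    v-mul      : ∀ x y → v (x * y) ≡ v x +∞ v y
    v-add      : ∀ x y → min∞ (v x) (v y) ≤∞ v (x + y)
    valring    : ∀ x y → ¬ (x ≈ 0#) → v x ≤∞ v y → ∃ λ z → y ≈ x * z

module Poly {c ℓ} (R : CommutativeRing c ℓ) where
  open CommutativeRing R

  coeff : List Carrier → ℕ → Carrier
  coeff []       _       = 0#
  coeff (a ∷ _)  zero    = a
  coeff (_ ∷ p)  (suc k) = coeff p k

  infixl 6 _+ₚ_
  infixl 7 _*ₚ_

  _+ₚ_ : List Carrier → List Carrier → List Carrier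
  []      +ₚ q       = q
  (a ∷ p) +ₚ []      = a ∷ p
  (a ∷ p) +ₚ (b ∷ q) = (a + b) ∷ (p +ₚ q)

  _*ₚ_ : List Carrier → List Carrier → List Carrier
  []      *ₚ q = []
  (a ∷ p) *ₚ q = map (a *_) q +ₚ (0# ∷ (p *ₚ q))

-- Condition (ii) for one index i, with v(a₀) = m finite:
--   m / j < v(aᵢ) / (j - i), cross-multiplied (j - i > 0, j > 0);
-- it holds automatically when v(aᵢ) = ∞ (aᵢ = 0).
slopeLess : ℕ → ℕ → ℕ → ℕ∞ → Set
slopeLess m j i (fin k) = m N.* (j ∸ i) < k N.* j
slopeLess m j i ∞       = ⊤

-- Suppose v(f₁(0)) = a > 0 and v(f₂(0)) = b > 0, so a + b = m := v(a₀).  Give the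
-- coefficient c of xⁱ the weight j·v(c) + m·i, whose level sets are the lines parallel
-- to the Newton-polygon segment from (0, m) to (j, 0).  Hypotheses (i) and (ii) say
-- that every coefficient of f has weight at least jm.  For each factor take the LAST
-- index Lₖ at which its weight is minimal, say μₖ.  At index L₁ + L₂ exactly one term of
-- the Cauchy product has the least weight μ₁ + μ₂, so f has weight μ₁ + μ₂ there, whence
-- jm ≤ μ₁ + μ₂ ≤ ja + jb = jm and μ₁ = ja, μ₂ = jb.  Then j·v + m·L₁ = ja gives j ∣ m·L₁,
-- so j ∣ L₁ by (iii), and a < m forces L₁ = 0; likewise L₂ = 0.  But then every term of
-- the Cauchy product at index j weighs more than jm, contradicting v(a_j) = 0.
module Submission where

open import Defs
open import Function using (_∘_; id)
open import Data.Nat using (ℕ; zero; suc; _∸_; _≤_; _<_; _≤?_; z≤n; s≤s)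
open import Data.Nat.Properties
  using ( ≤-refl; ≤-trans; <⇒≤; <⇒≱; 1+n≰n; n≤1+n; ⊓-glb; +-mono-≤; m≤n+m
        ; suc-injective; m≤n⇒m<n∨m≡n; ≤-<-connex; ≰⇒>)
open import Data.Nat.GCD using (gcd)
open import Data.Nat.Coprimality as Coprimality using (Coprime; gcd≡1⇒coprime; coprime-divisor)
open import Data.Nat.Divisibility using (_∣_; ∣⇒≤; ∣m+n∣m⇒∣n; m∣m*n)
open import Data.List using (List; []; _∷_; map; length)
open import Data.Product using (∃; ∃₂; _×_; _,_)
open import Data.Sum using (_⊎_; inj₁; inj₂; [_,_]′; map₂)
open import Data.Unit using (⊤; tt)
open import Data.Empty using (⊥-elim)
open import Relation.Nullary using (¬_; yes; no; contradiction)
open import Relation.Binary.PropositionalEquality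
open import Algebra.Bundles using (CommutativeRing)
import Algebra.Properties.Ring as RingProperties
import Algebra.Properties.Group as GroupProperties

≤∞-refl : ∀ {x} → x ≤∞ x
≤∞-refl {fin n} = fin≤fin ≤-refl
≤∞-refl {∞}     = ∞ ≤∞∞

≤∞-reflexive : ∀ {x y} → x ≡ y → x ≤∞ y
≤∞-reflexive refl = ≤∞-refl

≤∞-trans : ∀ {x y z} → x ≤∞ y → y ≤∞ z → x ≤∞ z
≤∞-trans (fin≤fin p) (fin≤fin q) = fin≤fin (≤-trans p q)
≤∞-trans _           (_ ≤∞∞)     = _ ≤∞∞

≤∞-≡∞ : ∀ {x y} → y ≡ ∞ → x ≤∞ y
≤∞-≡∞ refl = _ ≤∞∞

fin≤∞fin⁻¹ : ∀ {m n} → fin m ≤∞ fin n → m ≤ n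
fin≤∞fin⁻¹ (fin≤fin m≤n) = m≤n

fin-suc-≰∞ : ∀ {n} → ¬ (fin (suc n) ≤∞ fin n)
fin-suc-≰∞ (fin≤fin p) = 1+n≰n p

≤∞-≰∞-suc⇒≡ : ∀ {n x} → fin n ≤∞ x → ¬ (fin (suc n) ≤∞ x) → x ≡ fin n
≤∞-≰∞-suc⇒≡ {x = ∞}     _           n<x = contradiction (_ ≤∞∞) n<x
≤∞-≰∞-suc⇒≡ {x = fin k} (fin≤fin p) n<x with m≤n⇒m<n∨m≡n p
... | inj₁ n<k  = contradiction (fin≤fin n<k) n<x
... | inj₂ refl = refl

min∞-glb : ∀ {x y z} → z ≤∞ x → z ≤∞ y → z ≤∞ min∞ x y
min∞-glb (fin≤fin p) (fin≤fin q) = fin≤fin (⊓-glb p q)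
min∞-glb (fin≤fin p) (_ ≤∞∞)     = fin≤fin p
min∞-glb (_ ≤∞∞)     q           = q

+∞-mono-≤∞ : ∀ {x x′ y y′} → x ≤∞ x′ → y ≤∞ y′ → (x +∞ y) ≤∞ (x′ +∞ y′)
+∞-mono-≤∞ (fin≤fin p) (fin≤fin q) = fin≤fin (+-mono-≤ p q)
+∞-mono-≤∞ (fin≤fin p) (_ ≤∞∞)     = _ ≤∞∞
+∞-mono-≤∞ (_ ≤∞∞)     q           = _ ≤∞∞

y≤∞x+∞y : ∀ x {y} → y ≤∞ (x +∞ y)
y≤∞x+∞y (fin m) {fin n} = fin≤fin (m≤n+m n m)
y≤∞x+∞y (fin m) {∞}     = ∞ ≤∞∞
y≤∞x+∞y ∞       {y}     = y ≤∞∞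

-- Cauchy products of coefficient lists

module PolynomialCoefficients {c ℓ} (R : CommutativeRing c ℓ) where
  open CommutativeRing R
    using (Carrier; _≈_; _+_; _*_; 0#; +-cong; +-identityˡ; +-identityʳ; zeroˡ; zeroʳ)
    renaming (refl to ≈-refl; sym to ≈-sym; trans to ≈-trans)
  open Poly R

  sumUpTo : (ℕ → Carrier) → ℕ → Carrier
  sumUpTo g zero    = g 0
  sumUpTo g (suc k) = g 0 + sumUpTo (g ∘ suc) k

  sumUpTo-closed : ∀ {p} (P : Carrier → Set p) → (∀ {x y} → P x → P y → P (x + y)) →
                   ∀ g k → (∀ {i} → i ≤ k → P (g i)) → P (sumUpTo g k)
  sumUpTo-closed P P-+ g zero    Pg = Pg z≤n
  sumUpTo-closed P P-+ g (suc k) Pg =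
    P-+ (Pg z≤n) (sumUpTo-closed P P-+ (g ∘ suc) k (λ i≤k → Pg (s≤s i≤k)))

  cauchyTerm : List Carrier → List Carrier → ℕ → ℕ → Carrier
  cauchyTerm p q k i = coeff p i * coeff q (k ∸ i)

  coeff-+ₚ : ∀ p q k → coeff (p +ₚ q) k ≈ coeff p k + coeff q k
  coeff-+ₚ []      q       k       = ≈-sym (+-identityˡ _)
  coeff-+ₚ (a ∷ p) []      k       = ≈-sym (+-identityʳ _)
  coeff-+ₚ (a ∷ p) (b ∷ q) zero    = ≈-refl
  coeff-+ₚ (a ∷ p) (b ∷ q) (suc k) = coeff-+ₚ p q k

  coeff-map-* : ∀ a q k → coeff (map (a *_) q) k ≈ a * coeff q k
  coeff-map-* a []      k       = ≈-sym (zeroʳ a)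
  coeff-map-* a (b ∷ q) zero    = ≈-refl
  coeff-map-* a (b ∷ q) (suc k) = coeff-map-* a q k

  coeff-*ₚ : ∀ p q k → coeff (p *ₚ q) k ≈ sumUpTo (cauchyTerm p q k) k
  coeff-*ₚ []      q k       =
    ≈-sym (sumUpTo-closed (_≈ 0#) (λ x≈0 y≈0 → ≈-trans (+-cong x≈0 y≈0) (+-identityˡ 0#))
                          (cauchyTerm [] q k) k (λ _ → zeroˡ _))
  coeff-*ₚ (a ∷ p) q zero    =
    ≈-trans (coeff-+ₚ (map (a *_) q) _ 0) (≈-trans (+-identityʳ _) (coeff-map-* a q 0))
  coeff-*ₚ (a ∷ p) q (suc k) =
    ≈-trans (coeff-+ₚ (map (a *_) q) _ (suc k)) (+-cong (coeff-map-* a q (suc k)) (coeff-*ₚ p q k))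

  coeff-≥length : ∀ p {i} → length p ≤ i → coeff p i ≡ 0#
  coeff-≥length []      _         = refl
  coeff-≥length (a ∷ p) (s≤s len≤i) = coeff-≥length p len≤i

module Valuation {c ℓ} {R : CommutativeRing c ℓ} {v : CommutativeRing.Carrier R → ℕ∞}
                 (isDVR : IsDVR R v) where
  open CommutativeRing R using (Carrier; _+_; -_; 1#; +-comm; +-group)
  open RingProperties (CommutativeRing.ring R) using (-1*x≈-x)
  open GroupProperties +-group using (//-rightDividesʳ)
  open IsDVR isDVR
  open PolynomialCoefficients R using (sumUpTo; sumUpTo-closed)

  v-+-≥ : ∀ {z x y} → z ≤∞ v x → z ≤∞ v y → z ≤∞ v (x + y)
  v-+-≥ z≤vx z≤vy = ≤∞-trans (min∞-glb z≤vx z≤vy) (v-add _ _)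

  v-‿-≥ : ∀ {z} y → z ≤∞ v y → z ≤∞ v (- y)
  v-‿-≥ y z≤vy =
    ≤∞-trans (≤∞-trans z≤vy (y≤∞x+∞y (v (- 1#))))
             (≤∞-reflexive (trans (sym (v-mul (- 1#) y)) (v-cong (-1*x≈-x y))))

  v-+-strict : ∀ {e} x y → v x ≡ fin e → fin (suc e) ≤∞ v y → v (x + y) ≡ fin e
  v-+-strict {e} x y vx≡e e<vy =
    ≤∞-≰∞-suc⇒≡ (v-+-≥ (≤∞-reflexive (sym vx≡e)) (≤∞-trans (fin≤fin (n≤1+n e)) e<vy)) e≮vx+y
    where
    e≮vx+y : ¬ (fin (suc e) ≤∞ v (x + y))
    e≮vx+y e<vx+y = fin-suc-≰∞ (≤∞-trans (v-+-≥ e<vx+y (v-‿-≥ y e<vy))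
      (≤∞-reflexive (trans (v-cong (//-rightDividesʳ y x)) vx≡e)))

  v-sumUpTo-closed : ∀ {p} (P : ℕ∞ → Set p) → (∀ {x y} → x ≤∞ y → P x → P y) →
                     (∀ {x y} → P x → P y → P (min∞ x y)) →
                     ∀ g k → (∀ {i} → i ≤ k → P (v (g i))) → P (v (sumUpTo g k))
  v-sumUpTo-closed P P-up P-min =
    sumUpTo-closed (P ∘ v) (λ Pvx Pvy → P-up (v-add _ _) (P-min Pvx Pvy))

  v-sumUpTo-unique-min : ∀ {e} g k i₀ → i₀ ≤ k → v (g i₀) ≡ fin e →
                         (∀ {i} → i ≤ k → i ≢ i₀ → fin (suc e) ≤∞ v (g i)) →
                         v (sumUpTo g k) ≡ fin e
  v-sumUpTo-unique-min g zero    zero     _            vg₀≡e _      = vg₀≡e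
  v-sumUpTo-unique-min g (suc k) zero     _            vg₀≡e others =
    v-+-strict (g 0) _ vg₀≡e
      (v-sumUpTo-closed (fin _ ≤∞_) (λ x≤y z≤x → ≤∞-trans z≤x x≤y) min∞-glb
                        (g ∘ suc) k (λ i≤k → others (s≤s i≤k) λ ()))
  v-sumUpTo-unique-min g (suc k) (suc i₀) (s≤s i₀≤k) vg₀≡e others =
    trans (v-cong (+-comm (g 0) _))
      (v-+-strict _ (g 0)
        (v-sumUpTo-unique-min (g ∘ suc) k i₀ i₀≤k vg₀≡e
          (λ i≤k i≢i₀ → others (s≤s i≤k) (i≢i₀ ∘ suc-injective)))
        (others z≤n λ ()))

open import Data.Nat using (_+_; _*_; >-nonZero)
open import Data.Nat.Properties
  using ( +-comm; +-suc; *-comm; +-identityʳ; *-zeroʳ; *-distribˡ-+; *-distribˡ-⊓; +-distribʳ-⊓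
        ; ≤-antisym; +-monoˡ-≤; +-monoʳ-≤; +-cancelʳ-≤; +-cancelʳ-<; *-cancelˡ-<; *-monoʳ-≤
        ; *-monoʳ-<; +-monoʳ-<; <-irrefl; ≤-<-trans; ≤∧≢⇒<; m≤m+n; m<m+n; m+n∸m≡n; m∸n+n≡m
        ; m+[n∸m]≡n; m+n≤o⇒m≤o∸n
        ; module ≤-Reasoning)
open import Data.Nat.Tactic.RingSolver using (solve-∀)

linear-additive : ∀ j m e f i i′ → j * (e + f) + m * (i + i′) ≡ (j * e + m * i) + (j * f + m * i′)
linear-additive = solve-∀

≤-squeeze : ∀ {a b c d} → a ≤ c → b ≤ d → c + d ≤ a + b → a ≡ c
≤-squeeze {a} {b} {c} {d} a≤c b≤d c+d≤a+b =
  ≤-antisym a≤c (+-cancelʳ-≤ d c a (≤-trans c+d≤a+b (+-monoʳ-≤ a b≤d)))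

coprime-line⇒index≡0 : ∀ {j m e a L} → 0 < j → Coprime m j → a < m → j * e + m * L ≡ j * a → L ≡ 0
coprime-line⇒index≡0 {L = zero}  _ _ _ _ = refl
coprime-line⇒index≡0 {j} {m} {e} {a} {L@(suc _)} 0<j m⊥j a<m line =
  contradiction (begin-strict
    j * m         ≡⟨ *-comm j m ⟩
    m * j         ≤⟨ *-monoʳ-≤ m j≤L ⟩
    m * L         ≤⟨ m≤n+m (m * L) (j * e) ⟩
    j * e + m * L ≡⟨ line ⟩
    j * a         <⟨ *-monoʳ-< j {{>-nonZero 0<j}} a<m ⟩
    j * m         ∎) (<-irrefl refl)
  where
  open ≤-Reasoning
  j≤L : j ≤ L
  j≤L = ∣⇒≤ (coprime-divisor (Coprimality.sym m⊥j)
               (∣m+n∣m⇒∣n (subst (j ∣_) (sym line) (m∣m*n a)) (m∣m*n e)))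

+∞≡fin-split : ∀ {x y n} → x +∞ y ≡ fin n →
               x ≡ fin n ⊎ y ≡ fin n ⊎ ∃₂ λ a b → x ≡ fin (suc a) × y ≡ fin (suc b) × suc a + suc b ≡ n
+∞≡fin-split {fin zero}    {fin b}       refl = inj₂ (inj₁ refl)
+∞≡fin-split {fin (suc a)} {fin zero}    refl = inj₁ (cong fin (sym (+-identityʳ (suc a))))
+∞≡fin-split {fin (suc a)} {fin (suc b)} refl = inj₂ (inj₂ (a , b , refl , refl , refl))

-- Weights j·v + m·i

module Weight (j m : ℕ) where

  weight : ℕ∞ → ℕ → ℕ∞
  weight (fin e) i = fin (j * e + m * i)
  weight ∞       i = ∞

  weight-at-0 : ∀ e → weight (fin e) 0 ≡ fin (j * e)
  weight-at-0 e = cong fin (trans (cong (j * e +_) (*-zeroʳ m)) (+-identityʳ (j * e)))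

  weight-+∞ : ∀ x y i i′ → weight (x +∞ y) (i + i′) ≡ weight x i +∞ weight y i′
  weight-+∞ (fin e) (fin f) i i′ = cong fin (linear-additive j m e f i i′)
  weight-+∞ (fin e) ∞       i i′ = refl
  weight-+∞ ∞       y       i i′ = refl

  weight-mono : ∀ {x y} i → x ≤∞ y → weight x i ≤∞ weight y i
  weight-mono i (fin≤fin e≤f) = fin≤fin (+-monoˡ-≤ (m * i) (*-monoʳ-≤ j e≤f))
  weight-mono i (_ ≤∞∞)       = _ ≤∞∞

  weight-min∞ : ∀ x y i → weight (min∞ x y) i ≡ min∞ (weight x i) (weight y i)
  weight-min∞ (fin e) (fin f) i =
    cong fin (trans (cong (_+ m * i) (*-distribˡ-⊓ j e f)) (+-distribʳ-⊓ (m * i) (j * e) (j * f)))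
  weight-min∞ (fin e) ∞       i = refl
  weight-min∞ ∞       y       i = refl

  weight≡fin : ∀ {x i μ} → weight x i ≡ fin μ → ∃ λ e → x ≡ fin e × j * e + m * i ≡ μ
  weight≡fin {fin e} refl = e , refl , refl

  weight-cancel : ∀ {e i} x → fin (suc (j * e + m * i)) ≤∞ weight x i → fin (suc e) ≤∞ x
  weight-cancel {e} {i} (fin f) (fin≤fin p) =
    fin≤fin (*-cancelˡ-< j e f (+-cancelʳ-< (m * i) (j * e) (j * f) p))
  weight-cancel ∞ _ = _ ≤∞∞

  slopeLess⇒jm≤weight : ∀ {i} x → i ≤ j → slopeLess m j i x → fin (j * m) ≤∞ weight x i
  slopeLess⇒jm≤weight {i} (fin n) i≤j slope = fin≤fin (begin
    j * m               ≡⟨ *-comm j m ⟩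
    m * j               ≡⟨ cong (m *_) (sym (m∸n+n≡m i≤j)) ⟩
    m * (j ∸ i + i)     ≡⟨ *-distribˡ-+ m (j ∸ i) i ⟩
    m * (j ∸ i) + m * i ≤⟨ +-monoˡ-≤ (m * i) (<⇒≤ slope) ⟩
    n * j + m * i       ≡⟨ cong (_+ m * i) (*-comm n j) ⟩
    j * n + m * i       ∎)
    where open ≤-Reasoning
  slopeLess⇒jm≤weight ∞ _ _ = _ ≤∞∞

  j≤i⇒jm≤weight : ∀ {i} x → j ≤ i → fin (j * m) ≤∞ weight x i
  j≤i⇒jm≤weight {i} (fin n) j≤i = fin≤fin (begin
    j * m         ≡⟨ *-comm j m ⟩
    m * j         ≤⟨ *-monoʳ-≤ m j≤i ⟩
    m * i         ≤⟨ m≤n+m (m * i) (j * n) ⟩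
    j * n + m * i ∎)
    where open ≤-Reasoning
  j≤i⇒jm≤weight ∞ _ = _ ≤∞∞

  slopes⇒jm≤weight : ∀ (w : ℕ → ℕ∞) → w 0 ≡ fin m → (∀ i → 1 ≤ i → i < j → slopeLess m j i (w i)) →
                     ∀ k → fin (j * m) ≤∞ weight (w k) k
  slopes⇒jm≤weight w w₀≡m slopes zero    =
    ≤∞-reflexive (sym (trans (cong (λ x → weight x 0) w₀≡m) (weight-at-0 m)))
  slopes⇒jm≤weight w w₀≡m slopes (suc k) with ≤-<-connex j (suc k)
  ... | inj₁ j≤k = j≤i⇒jm≤weight (w (suc k)) j≤k
  ... | inj₂ k<j = slopeLess⇒jm≤weight (w (suc k)) (<⇒≤ k<j) (slopes (suc k) (s≤s z≤n) k<j)

-- Last minima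

record LastMinimum (w : ℕ → ℕ∞) (Dom : ℕ → Set) : Set where
  field
    index value : ℕ
    attained    : w index ≡ fin value
    minimal     : ∀ {i} → Dom i → fin value ≤∞ w i
    strictAfter : ∀ {i} → Dom i → index < i → fin (suc value) ≤∞ w i

fin-≤-or-> : ∀ μ x → (∃ λ e → x ≡ fin e × e ≤ μ) ⊎ fin (suc μ) ≤∞ x
fin-≤-or-> μ ∞       = inj₂ (_ ≤∞∞)
fin-≤-or-> μ (fin e) with e ≤? μ
... | yes e≤μ = inj₁ (e , refl , e≤μ)
... | no  e≰μ = inj₂ (fin≤fin (≰⇒> e≰μ))

≤-suc-elim : ∀ {p} {P : ℕ → Set p} {n} → (∀ {i} → i ≤ n → P i) → P (suc n) → ∀ {i} → i ≤ suc n → P i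
≤-suc-elim P≤n P₁₊ₙ i≤1+n with m≤n⇒m<n∨m≡n i≤1+n
... | inj₁ (s≤s i≤n) = P≤n i≤n
... | inj₂ refl      = P₁₊ₙ

lastMinimumUpTo : ∀ (w : ℕ → ℕ∞) n {μ₀} → w 0 ≡ fin μ₀ → LastMinimum w (_≤ n)
lastMinimumUpTo w zero    w₀≡μ₀ = record
  { index = 0 ; value = _ ; attained = w₀≡μ₀
  ; minimal = λ { z≤n → ≤∞-reflexive (sym w₀≡μ₀) }
  ; strictAfter = λ { z≤n () } }
lastMinimumUpTo w (suc n) w₀≡μ₀ with lastMinimumUpTo w n w₀≡μ₀
... | M with fin-≤-or-> (LastMinimum.value M) (w (suc n))
...   | inj₁ (e , w₁₊ₙ≡e , e≤μ) = record
  { index = suc n ; value = e ; attained = w₁₊ₙ≡e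
  ; minimal = ≤-suc-elim (λ i≤n → ≤∞-trans (fin≤fin e≤μ) (minimal i≤n)) (≤∞-reflexive (sym w₁₊ₙ≡e))
  ; strictAfter = λ i≤1+n 1+n<i → contradiction i≤1+n (<⇒≱ 1+n<i) }
  where open LastMinimum M
...   | inj₂ μ<w₁₊ₙ = record
  { index = index ; value = value ; attained = attained
  ; minimal = ≤-suc-elim minimal (≤∞-trans (fin≤fin (n≤1+n _)) μ<w₁₊ₙ)
  ; strictAfter = ≤-suc-elim strictAfter (λ _ → μ<w₁₊ₙ) }
  where open LastMinimum M

lastMinimum : ∀ (w : ℕ → ℕ∞) n {μ₀} → w 0 ≡ fin μ₀ → (∀ {i} → n < i → w i ≡ ∞) →
              LastMinimum w (λ _ → ⊤)
lastMinimum w n w₀≡μ₀ w-beyond = record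
  { index = index ; value = value ; attained = attained
  ; minimal = λ _ → everywhere (λ i≤n _ → minimal i≤n) tt
  ; strictAfter = λ _ → everywhere strictAfter }
  where
  open LastMinimum (lastMinimumUpTo w n w₀≡μ₀)
  everywhere : ∀ {z} {Q : ℕ → Set} → (∀ {i} → i ≤ n → Q i → z ≤∞ w i) → ∀ {i} → Q i → z ≤∞ w i
  everywhere bounded {i} with ≤-<-connex i n
  ... | inj₁ i≤n = bounded i≤n
  ... | inj₂ n<i = λ _ → ≤∞-≡∞ (w-beyond n<i)

module NewtonPolygon {c ℓ} {R : CommutativeRing c ℓ} {v : CommutativeRing.Carrier R → ℕ∞}
                     (isDVR : IsDVR R v) (j m : ℕ) where
  open CommutativeRing R using (Carrier)
  open Poly R using (coeff; _*ₚ_)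
  open IsDVR isDVR using (v-cong; v-mul; v-zero)
  open PolynomialCoefficients R using (sumUpTo; cauchyTerm; coeff-*ₚ; coeff-≥length)
  open Valuation isDVR using (v-sumUpTo-closed; v-sumUpTo-unique-min)
  open Weight j m

  coeffWeight : List Carrier → ℕ → ℕ∞
  coeffWeight p i = weight (v (coeff p i)) i

  Vertex : List Carrier → Set
  Vertex p = LastMinimum (coeffWeight p) (λ _ → ⊤)

  vertex : ∀ p {e} → v (coeff p 0) ≡ fin e → Vertex p
  vertex p v₀≡e = lastMinimum (coeffWeight p) (length p) (cong (λ x → weight x 0) v₀≡e) beyond
    where
    beyond : ∀ {i} → length p < i → coeffWeight p i ≡ ∞
    beyond {i} len<i = cong (λ x → weight x i) (trans (cong v (coeff-≥length p (<⇒≤ len<i))) v-zero)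

  vertex-value≤ : ∀ p {e} (V : Vertex p) → v (coeff p 0) ≡ fin e → LastMinimum.value V ≤ j * e
  vertex-value≤ p V v₀≡e = fin≤∞fin⁻¹ (≤∞-trans (LastMinimum.minimal V tt)
    (≤∞-reflexive (trans (cong (λ x → weight x 0) v₀≡e) (weight-at-0 _))))

  vertex-index≡0 : ∀ p {a} (V : Vertex p) → 0 < j → Coprime m j → a < m →
                   LastMinimum.value V ≡ j * a → LastMinimum.index V ≡ 0
  vertex-index≡0 p V 0<j m⊥j a<m μ≡ja with weight≡fin (LastMinimum.attained V)
  ... | _ , _ , line = coprime-line⇒index≡0 0<j m⊥j a<m (trans line μ≡ja)

  coeffWeight-*ₚ : ∀ p q k → coeffWeight (p *ₚ q) k ≡ weight (v (sumUpTo (cauchyTerm p q k) k)) k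
  coeffWeight-*ₚ p q k = cong (λ x → weight x k) (v-cong (coeff-*ₚ p q k))

  cauchyTerm-weight : ∀ p q {k i} → i ≤ k →
                      weight (v (cauchyTerm p q k i)) k ≡ coeffWeight p i +∞ coeffWeight q (k ∸ i)
  cauchyTerm-weight p q {k} {i} i≤k = begin
    weight (v (cauchyTerm p q k i)) k
      ≡⟨ cong (λ x → weight x k) (v-mul _ _) ⟩
    weight (v (coeff p i) +∞ v (coeff q (k ∸ i))) k
      ≡⟨ cong (weight _) (sym (m+[n∸m]≡n i≤k)) ⟩
    weight (v (coeff p i) +∞ v (coeff q (k ∸ i))) (i + (k ∸ i))
      ≡⟨ weight-+∞ _ _ i (k ∸ i) ⟩
    coeffWeight p i +∞ coeffWeight q (k ∸ i)
      ∎
    where open ≡-Reasoning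

  module Product (p q : List Carrier) (V₁ : Vertex p) (V₂ : Vertex q) where
    open LastMinimum V₁ using () renaming
      (index to L₁; value to μ₁; attained to attained₁; minimal to minimal₁; strictAfter to strictAfter₁)
    open LastMinimum V₂ using () renaming
      (index to L₂; value to μ₂; attained to attained₂; minimal to minimal₂; strictAfter to strictAfter₂)

    cauchyTerm-weight-> : ∀ {k i} → i ≤ k → L₁ < i ⊎ L₂ + i < k →
                          fin (suc (μ₁ + μ₂)) ≤∞ weight (v (cauchyTerm p q k i)) k
    cauchyTerm-weight-> {k} {i} i≤k off-vertex =
      ≤∞-trans bound (≤∞-reflexive (sym (cauchyTerm-weight p q i≤k)))
      where
      bound : fin (suc (μ₁ + μ₂)) ≤∞ (coeffWeight p i +∞ coeffWeight q (k ∸ i))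
      bound = [ (λ L₁<i → +∞-mono-≤∞ (strictAfter₁ tt L₁<i) (minimal₂ tt))
              , (λ L₂+i<k → subst (λ n → fin n ≤∞ (coeffWeight p i +∞ coeffWeight q (k ∸ i)))
                                  (+-suc μ₁ μ₂)
                  (+∞-mono-≤∞ (minimal₁ tt) (strictAfter₂ tt (m+n≤o⇒m≤o∸n (suc L₂) L₂+i<k)))) ]′
              off-vertex

    cauchyTerm-weight-at-vertex : weight (v (cauchyTerm p q (L₁ + L₂) L₁)) (L₁ + L₂) ≡ fin (μ₁ + μ₂)
    cauchyTerm-weight-at-vertex = trans (cauchyTerm-weight p q (m≤m+n L₁ L₂))
      (cong₂ _+∞_ attained₁ (trans (cong (coeffWeight q) (m+n∸m≡n L₁ L₂)) attained₂))

    -- The Cauchy term with index L₁ is the only one of least weight.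
    coeffWeight-at-vertex : coeffWeight (p *ₚ q) (L₁ + L₂) ≡ fin (μ₁ + μ₂)
    coeffWeight-at-vertex with weight≡fin cauchyTerm-weight-at-vertex
    ... | e , vterm≡e , je+mk≡μ = begin
      coeffWeight (p *ₚ q) (L₁ + L₂)
        ≡⟨ coeffWeight-*ₚ p q (L₁ + L₂) ⟩
      weight (v (sumUpTo (cauchyTerm p q (L₁ + L₂)) (L₁ + L₂))) (L₁ + L₂)
        ≡⟨ cong (λ x → weight x (L₁ + L₂))
                (v-sumUpTo-unique-min (cauchyTerm p q (L₁ + L₂)) (L₁ + L₂) L₁ (m≤m+n L₁ L₂)
                                      vterm≡e others) ⟩
      fin (j * e + m * (L₁ + L₂))
        ≡⟨ cong fin je+mk≡μ ⟩
      fin (μ₁ + μ₂)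
        ∎
      where
      open ≡-Reasoning
      others : ∀ {i} → i ≤ L₁ + L₂ → i ≢ L₁ → fin (suc e) ≤∞ v (cauchyTerm p q (L₁ + L₂) i)
      others {i} i≤k i≢L₁ = weight-cancel _
        (subst (λ μ → fin (suc μ) ≤∞ weight (v (cauchyTerm p q (L₁ + L₂) i)) (L₁ + L₂))
               (sym je+mk≡μ) (cauchyTerm-weight-> i≤k off-vertex))
        where
        off-vertex : L₁ < i ⊎ L₂ + i < L₁ + L₂
        off-vertex with ≤-<-connex i L₁
        ... | inj₁ i≤L₁ = inj₂ (subst (L₂ + i <_) (+-comm L₂ L₁) (+-monoʳ-< L₂ (≤∧≢⇒< i≤L₁ i≢L₁)))
        ... | inj₂ L₁<i = inj₁ L₁<i

    coeffWeight-beyond-vertex : ∀ {k} → L₁ + L₂ < k → fin (suc (μ₁ + μ₂)) ≤∞ coeffWeight (p *ₚ q) k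
    coeffWeight-beyond-vertex {k} k₀<k =
      ≤∞-trans (v-sumUpTo-closed μ<weight μ<weight-up μ<weight-min (cauchyTerm p q k) k μ<term-weight)
               (≤∞-reflexive (sym (coeffWeight-*ₚ p q k)))
      where
      μ<weight : ℕ∞ → Set
      μ<weight x = fin (suc (μ₁ + μ₂)) ≤∞ weight x k
      μ<weight-up : ∀ {x y} → x ≤∞ y → μ<weight x → μ<weight y
      μ<weight-up x≤y μ<x = ≤∞-trans μ<x (weight-mono k x≤y)
      μ<weight-min : ∀ {x y} → μ<weight x → μ<weight y → μ<weight (min∞ x y)
      μ<weight-min {x} {y} μ<x μ<y =
        ≤∞-trans (min∞-glb μ<x μ<y) (≤∞-reflexive (sym (weight-min∞ x y k)))
      μ<term-weight : ∀ {i} → i ≤ k → μ<weight (v (cauchyTerm p q k i))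
      μ<term-weight {i} i≤k with ≤-<-connex i L₁
      ... | inj₁ i≤L₁ = cauchyTerm-weight-> i≤k
        (inj₂ (≤-<-trans (+-monoʳ-≤ L₂ i≤L₁) (subst (_< k) (+-comm L₁ L₂) k₀<k)))
      ... | inj₂ L₁<i = cauchyTerm-weight-> i≤k (inj₁ L₁<i)

  positive-constant-terms⇒v[coeff-j]≢0 :
    ∀ p q {a b} → 0 < j → Coprime m j →
    v (coeff p 0) ≡ fin (suc a) → v (coeff q 0) ≡ fin (suc b) → suc a + suc b ≡ m →
    (∀ k → fin (j * m) ≤∞ coeffWeight (p *ₚ q) k) → v (coeff (p *ₚ q) j) ≢ fin 0
  positive-constant-terms⇒v[coeff-j]≢0 p q {a} {b} 0<j m⊥j vp₀ vq₀ a+b≡m jm≤weight vj≡0 =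
    fin-suc-≰∞ (subst (λ n → fin (suc n) ≤∞ fin n) μ₁+μ₂≡jm
      (≤∞-trans (coeffWeight-beyond-vertex vertex<j) (≤∞-reflexive weight-at-j)))
    where
    V₁ = vertex p vp₀
    V₂ = vertex q vq₀
    open LastMinimum V₁ using () renaming (index to L₁; value to μ₁)
    open LastMinimum V₂ using () renaming (index to L₂; value to μ₂)
    open Product p q V₁ V₂

    jm≡ : j * suc a + j * suc b ≡ j * m
    jm≡ = trans (sym (*-distribˡ-+ j (suc a) (suc b))) (cong (j *_) a+b≡m)

    jm≤μ₁+μ₂ : j * m ≤ μ₁ + μ₂
    jm≤μ₁+μ₂ = fin≤∞fin⁻¹ (≤∞-trans (jm≤weight (L₁ + L₂)) (≤∞-reflexive coeffWeight-at-vertex))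

    μ₁≡ : μ₁ ≡ j * suc a
    μ₁≡ = ≤-squeeze (vertex-value≤ p V₁ vp₀) (vertex-value≤ q V₂ vq₀)
      (subst (_≤ μ₁ + μ₂) (sym jm≡) jm≤μ₁+μ₂)

    μ₂≡ : μ₂ ≡ j * suc b
    μ₂≡ = ≤-squeeze (vertex-value≤ q V₂ vq₀) (vertex-value≤ p V₁ vp₀)
      (subst₂ _≤_ (trans (sym jm≡) (+-comm (j * suc a) (j * suc b))) (+-comm μ₁ μ₂) jm≤μ₁+μ₂)

    μ₁+μ₂≡jm : μ₁ + μ₂ ≡ j * m
    μ₁+μ₂≡jm = trans (cong₂ _+_ μ₁≡ μ₂≡) jm≡

    vertex<j : L₁ + L₂ < j
    vertex<j = subst (_< j) (sym (cong₂ _+_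
      (vertex-index≡0 p V₁ 0<j m⊥j (subst (suc a <_) a+b≡m (m<m+n (suc a) (s≤s z≤n))) μ₁≡)
      (vertex-index≡0 q V₂ 0<j m⊥j (subst (suc b <_) (trans (+-comm (suc b) (suc a)) a+b≡m)
                                          (m<m+n (suc b) (s≤s z≤n))) μ₂≡))) 0<j

    weight-at-j : coeffWeight (p *ₚ q) j ≡ fin (μ₁ + μ₂)
    weight-at-j = trans (cong (λ x → weight x j) vj≡0)
      (cong fin (trans (cong (_+ m * j) (*-zeroʳ j)) (trans (*-comm m j) (sym μ₁+μ₂≡jm))))

lemma9 : ∀ {c ℓ} (R : CommutativeRing c ℓ) → let open CommutativeRing R in let open Poly R in
    (v : Carrier → ℕ∞) → IsDVR R v →
    (f : List Carrier) (j : ℕ) → 1 ≤ j → j < length f →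
    v (coeff f j) ≡ fin 0 →
    (m : ℕ) → v (coeff f 0) ≡ fin m →
    (∀ i → 1 ≤ i → i < j → slopeLess m j i (v (coeff f i))) →
    gcd m j ≡ 1 →
    (f₁ f₂ : List Carrier) → (∀ k → coeff f k ≈ coeff (f₁ *ₚ f₂) k) →
    v (coeff f₁ 0) ≡ fin m ⊎ v (coeff f₂ 0) ≡ fin m
lemma9 R v isDVR f j 1≤j _ vj≡0 m v₀≡m slopes gcd≡1 f₁ f₂ f≈f₁f₂ =
  map₂ [ id , (λ (_ , _ , v₁₀ , v₂₀ , a+b≡m) → ⊥-elim
                 (positive-constant-terms⇒v[coeff-j]≢0 f₁ f₂ 1≤j m⊥j v₁₀ v₂₀ a+b≡m jm≤weight vj′≡0)) ]′
       (+∞≡fin-split v₁₀+v₂₀≡m)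
  where
  open Poly R using (coeff; _*ₚ_)
  open IsDVR isDVR using (v-cong; v-mul)
  open PolynomialCoefficients R using (coeff-*ₚ)
  open Weight j m using (weight; slopes⇒jm≤weight)
  open NewtonPolygon isDVR j m using (positive-constant-terms⇒v[coeff-j]≢0)

  v-f≡ : ∀ k → v (coeff f k) ≡ v (coeff (f₁ *ₚ f₂) k)
  v-f≡ k = v-cong (f≈f₁f₂ k)

  m⊥j : Coprime m j
  m⊥j = gcd≡1⇒coprime gcd≡1

  v₁₀+v₂₀≡m : v (coeff f₁ 0) +∞ v (coeff f₂ 0) ≡ fin m
  v₁₀+v₂₀≡m = trans (sym (v-mul _ _))
    (trans (sym (v-cong (coeff-*ₚ f₁ f₂ 0))) (trans (sym (v-f≡ 0)) v₀≡m))

  jm≤weight : ∀ k → fin (j * m) ≤∞ weight (v (coeff (f₁ *ₚ f₂) k)) k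
  jm≤weight k = subst (λ x → fin (j * m) ≤∞ weight x k) (v-f≡ k)
    (slopes⇒jm≤weight (v ∘ coeff f) v₀≡m slopes k)

  vj′≡0 : v (coeff (f₁ *ₚ f₂) j) ≡ fin 0
  vj′≡0 = trans (sym (v-f≡ j)) vj≡0
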